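{- Let $G_1,\dots,G_k$ and $H_1,\dots,H_t$ be Digraph placement games. Then there exists a Digraph placement game $G$ with \[ G=\{ -1,G_1,\dots,G_k \mid 1,H_1,\dots,H_t\}. \]
   Context: All games are short normal-play two-player combinatorial games (Left and Right; bounded play length, finitely many options, a player unable to move loses), written $\{\text{Left options}\mid\text{Right options}\}$; $0=\{\mid\}$, $1=\{0\mid\}$, $-1=\{\mid 0\}$. Equality $Y=Z$ means that for every game $X$ the disjunctive sums $X+Y$ and $X+Z$ (in which each move is made in exactly one component) have the same outcome. A Digraph placement game is played on a finite digraph with vertices coloured blue or red (not necessarily properly): on her turn Left chooses a remaining blue vertex and deletes it together with all its out-neighbours, on his turn Right does the same with a remaining red vertex; a player unable to move loses. -}

module Defs where

open import Data.Nat using (ℕ; zero; suc)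
open import Data.Fin using (Fin; splitAt)
open import Data.Bool using (Bool; true; false; _∧_; not; if_then_else_)
open import Data.List using (List; []; _∷_; length; map)
open import Data.List.Base using (lookup)
open import Data.Product using (Σ; _×_)
open import Data.Sum using ([_,_]′)
open import Data.Empty using (⊥)
open import Relation.Nullary using (¬_)
open import Relation.Binary.PropositionalEquality using (_≡_)
open import Function.Bundles using (_⇔_)
open import Data.Fin.Properties using (_≟_)
open import Relation.Nullary.Decidable using (⌊_⌋)
import Data.Nat as ℕ

-- Short combinatorial games: finitely many Left options (indexed by Fin m)
-- and Right options (indexed by Fin n).  Well-foundedness of the
-- inductive type gives bounded play length.

data Game : Set where
  mk : (m n : ℕ) → (Fin m → Game) → (Fin n → Game) → Game

⟨_∣_⟩ : List Game → List Game → Game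
⟨ ls ∣ rs ⟩ = mk (length ls) (length rs) (lookup ls) (lookup rs)

zeroG : Game
zeroG = ⟨ [] ∣ [] ⟩

oneG : Game
oneG = ⟨ zeroG ∷ [] ∣ [] ⟩

minusOneG : Game
minusOneG = ⟨ [] ∣ zeroG ∷ [] ⟩

infixl 6 _+G_
_+G_ : Game → Game → Game
mk m n L R +G mk m' n' L' R' =
  mk (m ℕ.+ m') (n ℕ.+ n')
     (λ k → [ (λ i → L i +G mk m' n' L' R') , (λ j → mk m n L R +G L' j) ]′ (splitAt m k))
     (λ k → [ (λ i → R i +G mk m' n' L' R') , (λ j → mk m n L R +G R' j) ]′ (splitAt n k))

-- Normal play: LeftFirst G  = Left, moving first in G, has a winning strategy;
--              RightFirst G = Right, moving first in G, has a winning strategy.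
LeftFirst  : Game → Set
RightFirst : Game → Set
LeftFirst  (mk m n L R) = Σ (Fin m) λ i → ¬ RightFirst (L i)
RightFirst (mk m n L R) = Σ (Fin n) λ j → ¬ LeftFirst (R j)

-- The outcome of a game is determined by the pair (LeftFirst, RightFirst).
SameOutcome : Game → Game → Set
SameOutcome G H = (LeftFirst G ⇔ LeftFirst H) × (RightFirst G ⇔ RightFirst H)

infix 4 _≈G_
_≈G_ : Game → Game → Set
Y ≈G Z = (X : Game) → SameOutcome (X +G Y) (X +G Z)

data Colour : Set where
  blue red : Colour

isBlue : Colour → Bool
isBlue blue = true
isBlue red  = false

-- A finite digraph on vertex set Fin size, with arc relation and a
-- (not necessarily proper) blue/red vertex colouring.
record Digraph : Set where
  field
    size   : ℕ
    arc    : Fin size → Fin size → Bool   -- arc v w ≡ true : there is an arc v → w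
    colour : Fin size → Colour

module _ (D : Digraph) where
  open Digraph D

  VSet : Set
  VSet = Fin size → Bool

  deleteV : Fin size → VSet → VSet
  deleteV v S w = S w ∧ not (⌊ v ≟ w ⌋ Data.Bool.∨ arc v w)

  allVertices : List (Fin size)
  allVertices = Data.List.allFin size

  filterB : (Fin size → Bool) → List (Fin size) → List (Fin size)
  filterB p [] = []
  filterB p (x ∷ xs) = if p x then x ∷ filterB p xs else filterB p xs

  leftMoves rightMoves : VSet → List (Fin size)
  leftMoves  S = filterB (λ v → S v ∧ isBlue (colour v)) allVertices
  rightMoves S = filterB (λ v → S v ∧ not (isBlue (colour v))) allVertices

  -- Every move deletes at least the chosen vertex, so fuel
  -- ≥ number of remaining vertices suffices for the exact game tree.
  positionGame : ℕ → VSet → Game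
  positionGame zero    S = zeroG
  positionGame (suc f) S =
    ⟨ map (λ v → positionGame f (deleteV v S)) (leftMoves S)
    ∣ map (λ v → positionGame f (deleteV v S)) (rightMoves S) ⟩

digraphGame : Digraph → Game
digraphGame D = positionGame D (Digraph.size D) (λ _ → true)

-- G has a blue gate vertex for each Left option and a red gate for each Right option, the options
-- -1 and 1 being the one-vertex red and blue digraphs. Playing a gate deletes everything but a copy
-- of that option's digraph, so gate moves reproduce the options of the target exactly. Every other
-- move is neutralised by spares: for each colour, more spare vertices than there are gate and copy
-- vertices, never deleted by a spare nor by a copy vertex of the opposite colour. After Left plays a
-- copy vertex or a spare, Right has more spares than Left has vertices, so the position is at most
-- -1 and the move is dominated by the option -1; symmetrically for Right. Hence G ≤ target ≤ G,
-- and games comparable both ways are equal in every disjunctive sum.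

module Submission where

open import Defs
open import Data.Bool using (Bool; true; false; _∧_; _∨_; not)
open import Data.Bool.Properties using (∧-conicalˡ; ∧-conicalʳ; ∧-zeroʳ; not-involutive)
open import Data.Empty using (⊥; ⊥-elim)
open import Data.Unit using (⊤; tt)
open import Data.Fin using (Fin; zero; suc; punchIn; punchOut; splitAt; _↑ˡ_; _↑ʳ_)
open import Data.Fin.Properties using (_≟_; +↔⊎; punchIn-punchOut; suc-injective; any?; splitAt-↑ˡ; splitAt-↑ʳ)
import Data.List as List
open import Data.List using ([]; [_]; map; lookup)
open import Data.List.Relation.Unary.Any using (here; there)
open import Data.List.Membership.Propositional using (_∈_)
open import Data.List.Membership.Propositional.Properties using (∈-allFin)
open import Data.Nat using (ℕ; zero; suc; pred; _+_; _≤_; _<_; z≤n; s≤s)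
open import Data.Nat.Properties
  using (≤-refl; ≤-reflexive; ≤-trans; ≤-pred; m≤n+m; +-suc; +-mono-≤; +-monoʳ-≤; +-mono-≤-<; module ≤-Reasoning)
open import Data.Product using (Σ; ∃-syntax; _×_; _,_; proj₁; proj₂)
open import Data.Sum using (_⊎_; inj₁; inj₂; [_,_]′)
open import Data.Sum.Properties using (≡-dec)
open import Data.Sum.Function.Propositional using (_⊎-↔_)
open import Data.Vec.Functional using (_∷_)
open import Function using (_∘_; id; case_of_)
open import Function.Bundles using (_↔_; Inverse; mk⇔; mk↔ₛ′)
open import Function.Properties.Inverse using (↔-refl; ↔-trans)
open import Relation.Nullary using (¬_; Dec; yes; no; ¬?)
open import Relation.Nullary.Decidable using (⌊_⌋)
open import Relation.Binary.PropositionalEquality using (_≡_; _≢_; refl; sym; trans; cong; cong₂; subst; subst₂; module ≡-Reasoning)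

LeftIx RightIx : Game → Set
LeftIx  (mk m _ _ _) = Fin m
RightIx (mk _ n _ _) = Fin n

leftOpt : (G : Game) → LeftIx G → Game
leftOpt (mk _ _ L _) = L

rightOpt : (G : Game) → RightIx G → Game
rightOpt (mk _ _ _ R) = R

infix 4 _≤G_ _⧏_ _≃G_

-- The recursive characterisation of the order of games; G ⧏ H reads "G is less than or confused with H".
_≤G_ _⧏_ : Game → Game → Set
G@(mk _ _ GL _) ≤G H@(mk _ _ _ HR) = (∀ i → GL i ⧏ H) × (∀ j → G ⧏ HR j)
G@(mk _ _ _ GR) ⧏ H@(mk _ _ HL _) = (∃[ j ] G ≤G HL j) ⊎ (∃[ i ] GR i ≤G H)

_≃G_ : Game → Game → Set
G ≃G H = G ≤G H × H ≤G G

⧏-inv : ∀ G H → G ⧏ H → (∃[ j ] G ≤G leftOpt H j) ⊎ (∃[ i ] rightOpt G i ≤G H)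
⧏-inv (mk _ _ _ _) (mk _ _ _ _) G⧏H = G⧏H

⧏-by-left : ∀ G H j → G ≤G leftOpt H j → G ⧏ H
⧏-by-left (mk _ _ _ _) (mk _ _ _ _) j G≤Hj = inj₁ (j , G≤Hj)

⧏-by-right : ∀ G H i → rightOpt G i ≤G H → G ⧏ H
⧏-by-right (mk _ _ _ _) (mk _ _ _ _) i Gi≤H = inj₂ (i , Gi≤H)

≤G-intro : ∀ G H → (∀ i → leftOpt G i ⧏ H) → (∀ j → G ⧏ rightOpt H j) → G ≤G H
≤G-intro (mk _ _ _ _) (mk _ _ _ _) left right = left , right

≤G-by-domination : ∀ G H →
  (∀ i → ∃[ j ] leftOpt G i ≤G leftOpt H j) →
  (∀ j → ∃[ i ] rightOpt G i ≤G rightOpt H j) → G ≤G H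
≤G-by-domination G@(mk _ _ GL _) H@(mk _ _ _ HR) left right =
  (λ i → let (j , Gi≤Hj) = left i  in ⧏-by-left  (GL i) H j Gi≤Hj) ,
  (λ j → let (i , Gi≤Hj) = right j in ⧏-by-right G (HR j) i Gi≤Hj)

leftFirst? : ∀ G → Dec (LeftFirst G)
rightFirst? : ∀ G → Dec (RightFirst G)
leftFirst?  (mk _ _ L _) = any? (λ i → ¬? (rightFirst? (L i)))
rightFirst? (mk _ _ _ R) = any? (λ j → ¬? (leftFirst? (R j)))

LeftFirst-+-inv : ∀ X A → LeftFirst (X +G A) →
  (∃[ i ] ¬ RightFirst (leftOpt X i +G A)) ⊎ (∃[ j ] ¬ RightFirst (X +G leftOpt A j))
LeftFirst-+-inv (mk m _ _ _) (mk _ _ _ _) (k , lose) with splitAt m k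
... | inj₁ i = inj₁ (i , lose)
... | inj₂ j = inj₂ (j , lose)

RightFirst-+-inv : ∀ X A → RightFirst (X +G A) →
  (∃[ i ] ¬ LeftFirst (rightOpt X i +G A)) ⊎ (∃[ j ] ¬ LeftFirst (X +G rightOpt A j))
RightFirst-+-inv (mk _ n _ _) (mk _ _ _ _) (k , lose) with splitAt n k
... | inj₁ i = inj₁ (i , lose)
... | inj₂ j = inj₂ (j , lose)

LeftFirst-+ˡ : ∀ X A i → ¬ RightFirst (leftOpt X i +G A) → LeftFirst (X +G A)
LeftFirst-+ˡ (mk m _ _ _) (mk m′ _ _ _) i lose =
  i ↑ˡ m′ , subst (¬_ ∘ RightFirst ∘ [ _ , _ ]′) (sym (splitAt-↑ˡ m i m′)) lose

LeftFirst-+ʳ : ∀ X A j → ¬ RightFirst (X +G leftOpt A j) → LeftFirst (X +G A)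
LeftFirst-+ʳ (mk m _ _ _) (mk m′ _ _ _) j lose =
  m ↑ʳ j , subst (¬_ ∘ RightFirst ∘ [ _ , _ ]′) (sym (splitAt-↑ʳ m m′ j)) lose

RightFirst-+ˡ : ∀ X A i → ¬ LeftFirst (rightOpt X i +G A) → RightFirst (X +G A)
RightFirst-+ˡ (mk _ n _ _) (mk _ n′ _ _) i lose =
  i ↑ˡ n′ , subst (¬_ ∘ LeftFirst ∘ [ _ , _ ]′) (sym (splitAt-↑ˡ n i n′)) lose

RightFirst-+ʳ : ∀ X A j → ¬ LeftFirst (X +G rightOpt A j) → RightFirst (X +G A)
RightFirst-+ʳ (mk _ n _ _) (mk _ n′ _ _) j lose =
  n ↑ʳ j , subst (¬_ ∘ LeftFirst ∘ [ _ , _ ]′) (sym (splitAt-↑ʳ n n′ j)) lose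

LeftFirst-mono      : ∀ A B X → A ≤G B → LeftFirst (X +G A) → LeftFirst (X +G B)
RightFirst-antimono : ∀ A B X → A ≤G B → RightFirst (X +G B) → RightFirst (X +G A)
LeftFirst-reversal  : ∀ A B X i → rightOpt A i ≤G B → ¬ RightFirst (X +G A) → LeftFirst (X +G B)
RightFirst-reversal : ∀ A B X j → A ≤G leftOpt B j → ¬ LeftFirst (X +G B) → RightFirst (X +G A)

LeftFirst-mono A@(mk _ _ AL _) B@(mk _ _ BL _) X@(mk _ _ XL _) A≤B@(AL⧏B , _) win =
  [ (λ (i , lose) → LeftFirst-+ˡ X B i (lose ∘ RightFirst-antimono A B (XL i) A≤B))
  , (λ (i , lose) →
      [ (λ (j , ALi≤BLj) → LeftFirst-+ʳ X B j (lose ∘ RightFirst-antimono (AL i) (BL j) X ALi≤BLj))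
      , (λ (r , ALiR≤B)  → LeftFirst-reversal (AL i) B X r ALiR≤B lose)
      ]′ (⧏-inv (AL i) B (AL⧏B i)))
  ]′ (LeftFirst-+-inv X A win)

RightFirst-antimono A@(mk _ _ _ AR) B@(mk _ _ _ BR) X@(mk _ _ _ XR) A≤B@(_ , A⧏BR) win =
  [ (λ (i , lose) → RightFirst-+ˡ X A i (lose ∘ LeftFirst-mono A B (XR i) A≤B))
  , (λ (j , lose) →
      [ (λ (l , A≤BRjL)  → RightFirst-reversal A (BR j) X l A≤BRjL lose)
      , (λ (i , ARi≤BRj) → RightFirst-+ʳ X A i (lose ∘ LeftFirst-mono (AR i) (BR j) X ARi≤BRj))
      ]′ (⧏-inv A (BR j) (A⧏BR j)))
  ]′ (RightFirst-+-inv X B win)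

-- Outcomes are decidable, so it suffices that Right's move from A to its option cannot win.
LeftFirst-reversal A@(mk _ _ _ AR) B X i ARi≤B lose with leftFirst? (X +G AR i)
... | yes win  = LeftFirst-mono (AR i) B X ARi≤B win
... | no ¬win = ⊥-elim (lose (RightFirst-+ʳ X A i ¬win))

RightFirst-reversal A B@(mk _ _ BL _) X j A≤BLj lose with rightFirst? (X +G BL j)
... | yes win  = RightFirst-antimono A (BL j) X A≤BLj win
... | no ¬win = ⊥-elim (lose (LeftFirst-+ʳ X B j ¬win))

≃G⇒≈G : ∀ {A B} → A ≃G B → A ≈G B
≃G⇒≈G {A} {B} (A≤B , B≤A) X =
  mk⇔ (LeftFirst-mono A B X A≤B) (LeftFirst-mono B A X B≤A) ,
  mk⇔ (RightFirst-antimono B A X B≤A) (RightFirst-antimono A B X A≤B)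

-- Subsets of Fin n and their sizes

_⊆_ : ∀ {n} → (Fin n → Bool) → (Fin n → Bool) → Set
p ⊆ q = ∀ v → p v ≡ true → q v ≡ true

∧-true : ∀ {a b} → a ≡ true → b ≡ true → a ∧ b ≡ true
∧-true refl refl = refl

∧-⊆ : ∀ {n} {p q : Fin n → Bool} (r : Fin n → Bool) → p ⊆ q → (λ v → p v ∧ r v) ⊆ (λ v → q v ∧ r v)
∧-⊆ {p = p} r p⊆q v pr = ∧-true (p⊆q v (∧-conicalˡ (p v) _ pr)) (∧-conicalʳ (p v) _ pr)

not⌊≟⌋⇒≢ : ∀ {n} {a b : Fin n} → not ⌊ a ≟ b ⌋ ≡ true → a ≢ b
not⌊≟⌋⇒≢ {a = a} {b} h a≡b with a ≟ b
... | yes _  = case h of λ ()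
... | no a≢b = a≢b a≡b

bit : Bool → ℕ
bit true  = 1
bit false = 0

count : ∀ {n} → (Fin n → Bool) → ℕ
count {zero}  p = 0
count {suc n} p = bit (p zero) + count (p ∘ suc)

bit-mono : ∀ a b → (a ≡ true → b ≡ true) → bit a ≤ bit b
bit-mono false b a⇒b = z≤n
bit-mono true  b a⇒b rewrite a⇒b refl = ≤-refl

count-mono : ∀ {n} (p q : Fin n → Bool) → p ⊆ q → count p ≤ count q
count-mono {zero}  p q p⊆q = z≤n
count-mono {suc n} p q p⊆q =
  +-mono-≤ (bit-mono _ _ (p⊆q zero)) (count-mono (p ∘ suc) (q ∘ suc) (p⊆q ∘ suc))

count-< : ∀ {n} (p q : Fin n → Bool) v → p ⊆ q → q v ≡ true → p v ≡ false → count p < count q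
count-< p q zero p⊆q qv pv rewrite qv | pv = s≤s (count-mono (p ∘ suc) (q ∘ suc) (p⊆q ∘ suc))
count-< p q (suc v) p⊆q qv pv =
  +-mono-≤-< (bit-mono _ _ (p⊆q zero)) (count-< (p ∘ suc) (q ∘ suc) v (p⊆q ∘ suc) qv pv)

count-remove : ∀ {n} (p q : Fin n → Bool) v →
  (∀ w → p w ≡ true → w ≢ v → q w ≡ true) → count p ≤ suc (count q)
count-remove p q zero keep =
  +-mono-≤ (bit-mono _ true λ _ → refl)
           (≤-trans (count-mono (p ∘ suc) (q ∘ suc) λ w pw → keep (suc w) pw λ ()) (m≤n+m _ (bit (q zero))))
count-remove p q (suc v) keep = begin
  bit (p zero) + count (p ∘ suc)
    ≤⟨ +-mono-≤ (bit-mono _ _ λ p₀ → keep zero p₀ λ ())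
                (count-remove (p ∘ suc) (q ∘ suc) v λ w pw w≢v → keep (suc w) pw (w≢v ∘ suc-injective)) ⟩
  bit (q zero) + suc (count (q ∘ suc))
    ≡⟨ +-suc (bit (q zero)) _ ⟩
  suc (count q) ∎
  where open ≤-Reasoning

count-witness : ∀ {n} (p : Fin n → Bool) → 0 < count p → ∃[ v ] p v ≡ true
count-witness {suc n} p pos with p zero in p₀
... | true  = zero , p₀
... | false = let (v , pv) = count-witness (p ∘ suc) pos in suc v , pv

count-pos : ∀ {n} (p : Fin n → Bool) v → p v ≡ true → 0 < count p
count-pos p zero    pv rewrite pv = s≤s z≤n
count-pos p (suc v) pv = ≤-trans (count-pos (p ∘ suc) v pv) (m≤n+m _ (bit (p zero)))

count≤0⇒none : ∀ {n} (p : Fin n → Bool) → count p ≤ 0 → ∀ v → p v ≡ false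
count≤0⇒none p c≤0 v with p v in pv
... | false = refl
... | true with () ← ≤-trans (count-pos p v pv) c≤0

count-all : ∀ n → count {n} (λ _ → true) ≡ n
count-all zero    = refl
count-all (suc n) = cong suc (count-all n)

count-none : ∀ {n} (p : Fin n → Bool) → (∀ v → p v ≡ false) → count p ≡ 0
count-none {zero}  p none = refl
count-none {suc n} p none rewrite none zero = count-none (p ∘ suc) (none ∘ suc)

_∖_ : ∀ {n} → (Fin n → Bool) → Fin n → (Fin n → Bool)
(p ∖ v) w = p w ∧ not ⌊ w ≟ v ⌋

∖-⊆ : ∀ {n} (p : Fin n → Bool) v → (p ∖ v) ⊆ p
∖-⊆ p v w = ∧-conicalˡ (p w) _

∖-self : ∀ {n} (p : Fin n → Bool) v → (p ∖ v) v ≡ false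
∖-self p v with v ≟ v
... | yes _  = ∧-zeroʳ (p v)
... | no v≢v = ⊥-elim (v≢v refl)

∖-keep : ∀ {n} (p : Fin n → Bool) {v w} → p w ≡ true → w ≢ v → (p ∖ v) w ≡ true
∖-keep p {v} {w} pw w≢v with w ≟ v
... | yes w≡v = ⊥-elim (w≢v w≡v)
... | no _ rewrite pw = refl

count-≤-image : ∀ {m n} (p : Fin n → Bool) (e : Fin m → Fin n) →
                (∀ v → p v ≡ true → ∃[ j ] e j ≡ v) → count p ≤ m
count-≤-image {zero} p e onto = ≤-reflexive (count-none p none)
  where
  none : ∀ v → p v ≡ false
  none v with p v in pv
  ... | false = refl
  ... | true with () ← proj₁ (onto v pv)
count-≤-image {suc m} p e onto =
  ≤-trans (count-remove p (p ∖ e zero) (e zero) (λ w → ∖-keep p))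
          (s≤s (count-≤-image (p ∖ e zero) (e ∘ suc) onto′))
  where
  onto′ : ∀ v → (p ∖ e zero) v ≡ true → ∃[ j ] e (suc j) ≡ v
  onto′ v pv with onto v (∖-⊆ p (e zero) v pv)
  ... | suc j , ej≡v = j , ej≡v
  ... | zero  , refl with () ← trans (sym pv) (∖-self p (e zero))

count-≥-injection : ∀ {m n} (p : Fin n → Bool) (e : Fin m → Fin n) →
                    (∀ {i j} → e i ≡ e j → i ≡ j) → (∀ j → p (e j) ≡ true) → m ≤ count p
count-≥-injection {zero}  p e e-inj hits = z≤n
count-≥-injection {suc m} p e e-inj hits =
  ≤-trans (s≤s (count-≥-injection (p ∖ e zero) (e ∘ suc) (suc-injective ∘ e-inj) hits′))
          (count-< (p ∖ e zero) p (e zero) (∖-⊆ p (e zero)) (hits zero) (∖-self p (e zero)))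
  where
  hits′ : ∀ j → (p ∖ e zero) (e (suc j)) ≡ true
  hits′ j = ∖-keep p (hits (suc j)) λ e₁≡e₀ → case e-inj e₁≡e₀ of λ ()

module _ (D : Digraph) where
  open Digraph D

  LeftMove RightMove : VSet D → Fin size → Set
  LeftMove  S v = S v ∧ isBlue (colour v) ≡ true
  RightMove S v = S v ∧ not (isBlue (colour v)) ≡ true

  private
    lookup-filterB : ∀ (g : Fin size → Game) p xs i →
      ∃[ v ] p v ≡ true × lookup (map g (filterB D p xs)) i ≡ g v
    lookup-filterB g p (x List.∷ xs) i with p x in px
    lookup-filterB g p (x List.∷ xs) zero    | true  = x , px , refl
    lookup-filterB g p (x List.∷ xs) (suc i) | true  = lookup-filterB g p xs i
    lookup-filterB g p (x List.∷ xs) i       | false = lookup-filterB g p xs i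

    filterB-lookup : ∀ (g : Fin size → Game) p xs v → v ∈ xs → p v ≡ true →
      ∃[ i ] lookup (map g (filterB D p xs)) i ≡ g v
    filterB-lookup g p (x List.∷ xs) v v∈ pv with p x in px | v∈
    ... | true  | here refl = zero , refl
    ... | true  | there v∈xs = let (i , eq) = filterB-lookup g p xs v v∈xs pv in suc i , eq
    ... | false | there v∈xs = filterB-lookup g p xs v v∈xs pv
    ... | false | here refl with () ← trans (sym pv) px

    filterB-none : ∀ p xs → (∀ v → p v ≡ false) → filterB D p xs ≡ []
    filterB-none p []       none = refl
    filterB-none p (x List.∷ xs) none rewrite none x = filterB-none p xs none

  leftOpt⇒LeftMove : ∀ f S i → ∃[ v ] LeftMove S v ×
    leftOpt (positionGame D (suc f) S) i ≡ positionGame D f (deleteV D v S)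
  leftOpt⇒LeftMove f S = lookup-filterB _ _ (allVertices D)

  rightOpt⇒RightMove : ∀ f S i → ∃[ v ] RightMove S v ×
    rightOpt (positionGame D (suc f) S) i ≡ positionGame D f (deleteV D v S)
  rightOpt⇒RightMove f S = lookup-filterB _ _ (allVertices D)

  LeftMove⇒leftOpt : ∀ f S v → LeftMove S v →
    ∃[ i ] leftOpt (positionGame D (suc f) S) i ≡ positionGame D f (deleteV D v S)
  LeftMove⇒leftOpt f S v = filterB-lookup _ _ (allVertices D) v (∈-allFin v)

  RightMove⇒rightOpt : ∀ f S v → RightMove S v →
    ∃[ i ] rightOpt (positionGame D (suc f) S) i ≡ positionGame D f (deleteV D v S)
  RightMove⇒rightOpt f S v = filterB-lookup _ _ (allVertices D) v (∈-allFin v)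

  positionGame-∅ : ∀ f S → (∀ v → S v ≡ false) → positionGame D f S ≡ zeroG
  positionGame-∅ zero    S empty = refl
  positionGame-∅ (suc f) S empty
    rewrite filterB-none (λ v → S v ∧ isBlue (colour v)) (allVertices D) (λ v → cong (_∧ _) (empty v))
          | filterB-none (λ v → S v ∧ not (isBlue (colour v))) (allVertices D) (λ v → cong (_∧ _) (empty v))
    = refl

  deleteV-⊆ : ∀ v S → deleteV D v S ⊆ S
  deleteV-⊆ v S w = ∧-conicalˡ (S w) _

  deleteV-self : ∀ v S → deleteV D v S v ≡ false
  deleteV-self v S with v ≟ v
  ... | yes _  = ∧-zeroʳ (S v)
  ... | no v≢v = ⊥-elim (v≢v refl)

  deleteV-keep : ∀ v S w → S w ≡ true → v ≢ w → arc v w ≡ false → deleteV D v S w ≡ true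
  deleteV-keep v S w Sw v≢w ¬arc with v ≟ w
  ... | yes v≡w = ⊥-elim (v≢w v≡w)
  ... | no _ rewrite Sw | ¬arc = refl

  count-deleteV : ∀ v S → S v ≡ true → count (deleteV D v S) < count S
  count-deleteV v S Sv = count-< (deleteV D v S) S v (deleteV-⊆ v S) Sv (deleteV-self v S)

-- Relabelling vertices

zeroG-≃ : zeroG ≃G zeroG
zeroG-≃ = ((λ ()) , (λ ())) , ((λ ()) , (λ ()))

≃G-by-options : ∀ G H →
  (∀ i → ∃[ j ] leftOpt G i ≃G leftOpt H j) → (∀ j → ∃[ i ] leftOpt G i ≃G leftOpt H j) →
  (∀ i → ∃[ j ] rightOpt G i ≃G rightOpt H j) → (∀ j → ∃[ i ] rightOpt G i ≃G rightOpt H j) →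
  G ≃G H
≃G-by-options G H leftᴳ leftᴴ rightᴳ rightᴴ =
  ≤G-by-domination G H (λ i → let (j , eq) = leftᴳ i in j , proj₁ eq)
                       (λ j → let (i , eq) = rightᴴ j in i , proj₁ eq) ,
  ≤G-by-domination H G (λ j → let (i , eq) = leftᴴ j in i , proj₂ eq)
                       (λ i → let (j , eq) = rightᴳ i in j , proj₂ eq)

record Embedding (E D : Digraph) : Set where
  private
    module E = Digraph E
    module D = Digraph D
  field
    embed           : Fin E.size → Fin D.size
    embed-injective : ∀ {u v} → embed u ≡ embed v → u ≡ v
    embed-colour    : ∀ v → D.colour (embed v) ≡ E.colour v
    embed-arc       : ∀ u v → D.arc (embed u) (embed v) ≡ E.arc u v

module _ {E D : Digraph} (φ : Embedding E D) where
  open Embedding φ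
  private
    module E = Digraph E
    module D = Digraph D

  record IsImage (S : VSet D) (T : VSet E) : Set where
    field
      image-agrees : ∀ v → S (embed v) ≡ T v
      image-only   : ∀ w → S w ≡ true → ∃[ v ] embed v ≡ w
  open IsImage

  IsImage-deleteV : ∀ {S T} v → IsImage S T → IsImage (deleteV D (embed v) S) (deleteV E v T)
  IsImage-deleteV {S} {T} v S≅T = record
    { image-agrees = λ u → cong₂ (λ a b → a ∧ not b) (image-agrees S≅T u)
                                 (cong₂ _∨_ (⌊≟⌋-embed u) (embed-arc v u))
    ; image-only   = λ w → image-only S≅T w ∘ deleteV-⊆ D (embed v) S w
    }
    where
    ⌊≟⌋-embed : ∀ u → ⌊ embed v ≟ embed u ⌋ ≡ ⌊ v ≟ u ⌋
    ⌊≟⌋-embed u with embed v ≟ embed u | v ≟ u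
    ... | yes _  | yes _   = refl
    ... | no _   | no _    = refl
    ... | yes eq | no v≢u  = ⊥-elim (v≢u (embed-injective eq))
    ... | no ne  | yes refl = ⊥-elim (ne refl)

  -- The fuels may differ: any fuel bounding the number of remaining vertices gives the full game tree.
  positionGame-embed : ∀ f g S T → IsImage S T → count S ≤ f → count T ≤ g →
                       positionGame D f S ≃G positionGame E g T
  positionGame-embed zero g S T S≅T cS cT =
    subst (zeroG ≃G_) (sym (positionGame-∅ E g T T-empty)) zeroG-≃
    where
    T-empty : ∀ v → T v ≡ false
    T-empty v = trans (sym (image-agrees S≅T v)) (count≤0⇒none S cS (embed v))
  positionGame-embed (suc f) zero S T S≅T cS cT =
    subst (_≃G zeroG) (sym (positionGame-∅ D (suc f) S S-empty)) zeroG-≃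
    where
    S-empty : ∀ w → S w ≡ false
    S-empty w with S w in Sw
    ... | false = refl
    ... | true with image-only S≅T w Sw
    ...   | v , refl with () ← trans (sym (count≤0⇒none T cT v)) (trans (sym (image-agrees S≅T v)) Sw)
  positionGame-embed (suc f) (suc g) S T S≅T cS cT =
    ≃G-by-options (positionGame D (suc f) S) (positionGame E (suc g) T) leftᴰ leftᴱ rightᴰ rightᴱ
    where
    next : ∀ v → T v ≡ true →
           positionGame D f (deleteV D (embed v) S) ≃G positionGame E g (deleteV E v T)
    next v Tv = positionGame-embed f g _ _ (IsImage-deleteV v S≅T)
      (≤-pred (≤-trans (count-deleteV D (embed v) S (trans (image-agrees S≅T v) Tv)) cS))
      (≤-pred (≤-trans (count-deleteV E v T Tv) cT))

    moves-agree : ∀ (side : Bool → Bool) v →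
      S (embed v) ∧ side (isBlue (D.colour (embed v))) ≡ T v ∧ side (isBlue (E.colour v))
    moves-agree side v = cong₂ (λ a c → a ∧ side (isBlue c)) (image-agrees S≅T v) (embed-colour v)

    leftᴰ : ∀ i → ∃[ j ] leftOpt (positionGame D (suc f) S) i ≃G leftOpt (positionGame E (suc g) T) j
    leftᴰ i with leftOpt⇒LeftMove D f S i
    ... | w , mv , eqᴰ with image-only S≅T w (∧-conicalˡ _ _ mv)
    ... | v , refl = let mvᴱ = trans (sym (moves-agree id v)) mv ; (j , eqᴱ) = LeftMove⇒leftOpt E g T v mvᴱ
                     in j , subst₂ _≃G_ (sym eqᴰ) (sym eqᴱ) (next v (∧-conicalˡ _ _ mvᴱ))

    rightᴰ : ∀ i → ∃[ j ] rightOpt (positionGame D (suc f) S) i ≃G rightOpt (positionGame E (suc g) T) j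
    rightᴰ i with rightOpt⇒RightMove D f S i
    ... | w , mv , eqᴰ with image-only S≅T w (∧-conicalˡ _ _ mv)
    ... | v , refl = let mvᴱ = trans (sym (moves-agree not v)) mv ; (j , eqᴱ) = RightMove⇒rightOpt E g T v mvᴱ
                     in j , subst₂ _≃G_ (sym eqᴰ) (sym eqᴱ) (next v (∧-conicalˡ _ _ mvᴱ))

    leftᴱ : ∀ j → ∃[ i ] leftOpt (positionGame D (suc f) S) i ≃G leftOpt (positionGame E (suc g) T) j
    leftᴱ j with leftOpt⇒LeftMove E g T j
    ... | v , mvᴱ , eqᴱ = let (i , eqᴰ) = LeftMove⇒leftOpt D f S (embed v) (trans (moves-agree id v) mvᴱ) in
                          i , subst₂ _≃G_ (sym eqᴰ) (sym eqᴱ) (next v (∧-conicalˡ _ _ mvᴱ))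

    rightᴱ : ∀ j → ∃[ i ] rightOpt (positionGame D (suc f) S) i ≃G rightOpt (positionGame E (suc g) T) j
    rightᴱ j with rightOpt⇒RightMove E g T j
    ... | v , mvᴱ , eqᴱ = let (i , eqᴰ) = RightMove⇒rightOpt D f S (embed v) (trans (moves-agree not v) mvᴱ) in
                          i , subst₂ _≃G_ (sym eqᴰ) (sym eqᴱ) (next v (∧-conicalˡ _ _ mvᴱ))

-- Spare vertices

negNatG natG : ℕ → Game
negNatG zero    = zeroG
negNatG (suc k) = ⟨ [] ∣ [ negNatG k ] ⟩
natG zero       = zeroG
natG (suc k)    = ⟨ [ natG k ] ∣ [] ⟩

-- The opponent's vertices are those whose colour satisfies opp; the spares belong to the other player.
module SpareCounting (D : Digraph) (opp : Colour → Bool) (spare : Fin (Digraph.size D) → Bool)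
  (spare-not-opp : ∀ s → spare s ≡ true → opp (Digraph.colour D s) ≡ false)
  (spares-independent : ∀ s w → spare s ≡ true → spare w ≡ true → s ≢ w → Digraph.arc D s w ≡ false)
  where
  open Digraph D

  OpponentMove : VSet D → Fin size → Set
  OpponentMove S v = S v ∧ opp (colour v) ≡ true

  opponents spares : VSet D → ℕ
  opponents S = count (λ v → S v ∧ opp (colour v))
  spares    S = count (λ v → S v ∧ spare v)

  Shielded : VSet D → Set
  Shielded S = ∀ v w → S v ≡ true → opp (colour v) ≡ true → spare w ≡ true → arc v w ≡ false

  Shielded-deleteV : ∀ v S → Shielded S → Shielded (deleteV D v S)
  Shielded-deleteV v S shielded u w = shielded u w ∘ deleteV-⊆ D v S u

  spares≤count : ∀ S → spares S ≤ count S
  spares≤count S = count-mono _ S λ v → ∧-conicalˡ (S v) _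

  opponents-deleteV : ∀ v S → opponents (deleteV D v S) ≤ opponents S
  opponents-deleteV v S = count-mono _ _ (∧-⊆ (opp ∘ colour) (deleteV-⊆ D v S))

  opponents-OpponentMove : ∀ v S → OpponentMove S v → opponents (deleteV D v S) < opponents S
  opponents-OpponentMove v S mv =
    count-< _ _ v (∧-⊆ (opp ∘ colour) (deleteV-⊆ D v S)) mv (cong (_∧ opp (colour v)) (deleteV-self D v S))

  spares-OpponentMove : ∀ v S → Shielded S → OpponentMove S v → spares S ≤ spares (deleteV D v S)
  spares-OpponentMove v S shielded mv = count-mono _ _ λ w Sw∧spw →
    let Sv = ∧-conicalˡ (S v) _ mv ; oppv = ∧-conicalʳ (S v) _ mv
        Sw = ∧-conicalˡ (S w) _ Sw∧spw ; spw = ∧-conicalʳ (S w) _ Sw∧spw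
        v≢w : v ≢ w
        v≢w = λ { refl → case trans (sym oppv) (spare-not-opp v spw) of λ () }
    in ∧-true (deleteV-keep D v S w Sw v≢w (shielded v w Sv oppv spw)) spw

  spares-spareMove : ∀ s S → spare s ≡ true → spares S ≤ suc (spares (deleteV D s S))
  spares-spareMove s S sps = count-remove _ _ s λ w Sw∧spw w≢s →
    let Sw = ∧-conicalˡ (S w) _ Sw∧spw ; spw = ∧-conicalʳ (S w) _ Sw∧spw
    in ∧-true (deleteV-keep D s S w Sw (w≢s ∘ sym) (spares-independent s w sps spw (w≢s ∘ sym))) spw

module RedSpares (D : Digraph) (spare : Fin (Digraph.size D) → Bool)
  (spare-red : ∀ s → spare s ≡ true → isBlue (Digraph.colour D s) ≡ false)
  (spares-independent : ∀ s w → spare s ≡ true → spare w ≡ true → s ≢ w → Digraph.arc D s w ≡ false)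
  where
  open Digraph D
  open SpareCounting D isBlue spare spare-red spares-independent public

  -- Right answers each Left move, and uses each of his own turns, by playing a spare. Left can
  -- never delete spares, so k more spares than Left has vertices make the position at most -k.
  positionGame≤negNatG : ∀ f S k → Shielded S → count S ≤ f → k + opponents S ≤ spares S →
                         positionGame D f S ≤G negNatG k
  spare-reply : ∀ f S k → Shielded S → count S ≤ f → suc k + opponents S ≤ spares S →
                positionGame D f S ⧏ negNatG k

  positionGame≤negNatG zero S zero    _ _ _ = (λ ()) , (λ ())
  positionGame≤negNatG zero S (suc k) _ c≤0 bound with () ← ≤-trans bound (≤-trans (spares≤count S) c≤0)
  positionGame≤negNatG (suc f) S k shielded c≤f bound =
    ≤G-intro (positionGame D (suc f) S) (negNatG k) leftOpts (rightOpts k bound)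
    where
    leftOpts : ∀ i → leftOpt (positionGame D (suc f) S) i ⧏ negNatG k
    leftOpts i with leftOpt⇒LeftMove D f S i
    ... | v , mv , eq = subst (_⧏ negNatG k) (sym eq)
      (spare-reply f (deleteV D v S) k (Shielded-deleteV v S shielded)
        (≤-pred (≤-trans (count-deleteV D v S (∧-conicalˡ (S v) _ mv)) c≤f))
        (begin
          suc k + opponents (deleteV D v S) ≡⟨ sym (+-suc k _) ⟩
          k + suc (opponents (deleteV D v S)) ≤⟨ +-monoʳ-≤ k (opponents-OpponentMove v S mv) ⟩
          k + opponents S                     ≤⟨ bound ⟩
          spares S                            ≤⟨ spares-OpponentMove v S shielded mv ⟩
          spares (deleteV D v S)              ∎))
      where open ≤-Reasoning
    rightOpts : ∀ k → k + opponents S ≤ spares S → ∀ j → positionGame D (suc f) S ⧏ rightOpt (negNatG k) j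
    rightOpts (suc k) bound zero = spare-reply (suc f) S k shielded c≤f bound

  spare-reply f S k shielded c≤f bound with count-witness (λ v → S v ∧ spare v) (≤-trans (s≤s z≤n) bound)
  spare-reply zero    S k shielded c≤f bound | s , Ss∧sps
    with () ← ≤-trans (count-pos S s (∧-conicalˡ (S s) _ Ss∧sps)) c≤f
  spare-reply (suc f) S k shielded c≤f bound | s , Ss∧sps =
    let Ss = ∧-conicalˡ (S s) _ Ss∧sps ; sps = ∧-conicalʳ (S s) _ Ss∧sps
        (j , eq) = RightMove⇒rightOpt D f S s (∧-true Ss (cong not (spare-red s sps)))
    in ⧏-by-right (positionGame D (suc f) S) (negNatG k) j (subst (_≤G negNatG k) (sym eq)
         (positionGame≤negNatG f (deleteV D s S) k (Shielded-deleteV s S shielded)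
           (≤-pred (≤-trans (count-deleteV D s S Ss) c≤f))
           (≤-pred (begin
             suc (k + opponents (deleteV D s S)) ≤⟨ s≤s (+-monoʳ-≤ k (opponents-deleteV s S)) ⟩
             suc k + opponents S                 ≤⟨ bound ⟩
             spares S                            ≤⟨ spares-spareMove s S sps ⟩
             suc (spares (deleteV D s S))        ∎))))
    where open ≤-Reasoning

module BlueSpares (D : Digraph) (spare : Fin (Digraph.size D) → Bool)
  (spare-blue : ∀ s → spare s ≡ true → isBlue (Digraph.colour D s) ≡ true)
  (spares-independent : ∀ s w → spare s ≡ true → spare w ≡ true → s ≢ w → Digraph.arc D s w ≡ false)
  where
  open Digraph D
  open SpareCounting D (not ∘ isBlue) spare (λ s → cong not ∘ spare-blue s) spares-independent public

  natG≤positionGame : ∀ f S k → Shielded S → count S ≤ f → k + opponents S ≤ spares S →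
                      natG k ≤G positionGame D f S
  spare-reply : ∀ f S k → Shielded S → count S ≤ f → suc k + opponents S ≤ spares S →
                natG k ⧏ positionGame D f S

  natG≤positionGame zero S zero    _ _ _ = (λ ()) , (λ ())
  natG≤positionGame zero S (suc k) _ c≤0 bound with () ← ≤-trans bound (≤-trans (spares≤count S) c≤0)
  natG≤positionGame (suc f) S k shielded c≤f bound =
    ≤G-intro (natG k) (positionGame D (suc f) S) (leftOpts k bound) rightOpts
    where
    rightOpts : ∀ j → natG k ⧏ rightOpt (positionGame D (suc f) S) j
    rightOpts j with rightOpt⇒RightMove D f S j
    ... | v , mv , eq = subst (natG k ⧏_) (sym eq)
      (spare-reply f (deleteV D v S) k (Shielded-deleteV v S shielded)
        (≤-pred (≤-trans (count-deleteV D v S (∧-conicalˡ (S v) _ mv)) c≤f))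
        (begin
          suc k + opponents (deleteV D v S) ≡⟨ sym (+-suc k _) ⟩
          k + suc (opponents (deleteV D v S)) ≤⟨ +-monoʳ-≤ k (opponents-OpponentMove v S mv) ⟩
          k + opponents S                     ≤⟨ bound ⟩
          spares S                            ≤⟨ spares-OpponentMove v S shielded mv ⟩
          spares (deleteV D v S)              ∎))
      where open ≤-Reasoning
    leftOpts : ∀ k → k + opponents S ≤ spares S → ∀ i → leftOpt (natG k) i ⧏ positionGame D (suc f) S
    leftOpts (suc k) bound zero = spare-reply (suc f) S k shielded c≤f bound

  spare-reply f S k shielded c≤f bound with count-witness (λ v → S v ∧ spare v) (≤-trans (s≤s z≤n) bound)
  spare-reply zero    S k shielded c≤f bound | s , Ss∧sps
    with () ← ≤-trans (count-pos S s (∧-conicalˡ (S s) _ Ss∧sps)) c≤f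
  spare-reply (suc f) S k shielded c≤f bound | s , Ss∧sps =
    let Ss = ∧-conicalˡ (S s) _ Ss∧sps ; sps = ∧-conicalʳ (S s) _ Ss∧sps
        (i , eq) = LeftMove⇒leftOpt D f S s (∧-true Ss (spare-blue s sps))
    in ⧏-by-left (natG k) (positionGame D (suc f) S) i (subst (natG k ≤G_) (sym eq)
         (natG≤positionGame f (deleteV D s S) k (Shielded-deleteV s S shielded)
           (≤-pred (≤-trans (count-deleteV D s S Ss) c≤f))
           (≤-pred (begin
             suc (k + opponents (deleteV D s S)) ≤⟨ s≤s (+-monoʳ-≤ k (opponents-deleteV s S)) ⟩
             suc k + opponents S                 ≤⟨ bound ⟩
             spares S                            ≤⟨ spares-spareMove s S sps ⟩
             suc (spares (deleteV D s S))        ∎))))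
    where open ≤-Reasoning

-- The construction

∑ : ∀ {a} → (Fin a → ℕ) → ℕ
∑ {zero}  sz = 0
∑ {suc a} sz = sz zero + ∑ (sz ∘ suc)

Σ-Fin↔ : ∀ {a} (sz : Fin a → ℕ) → Fin (∑ sz) ↔ Σ (Fin a) (Fin ∘ sz)
Σ-Fin↔ {zero}  sz = mk↔ₛ′ (λ ()) (λ { (() , _) }) (λ { (() , _) }) (λ ())
Σ-Fin↔ {suc a} sz = ↔-trans +↔⊎ (↔-trans (↔-refl ⊎-↔ Σ-Fin↔ (sz ∘ suc)) split)
  where
  split : (Fin (sz zero) ⊎ Σ (Fin a) (Fin ∘ sz ∘ suc)) ↔ Σ (Fin (suc a)) (Fin ∘ sz)
  split = mk↔ₛ′ [ (zero ,_) , (λ (i , u) → suc i , u) ]′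
                (λ { (zero , u) → inj₁ u ; (suc i , u) → inj₂ (i , u) })
                (λ { (zero , u) → refl ; (suc i , u) → refl })
                (λ { (inj₁ u) → refl ; (inj₂ (i , u)) → refl })

opposite : Colour → Colour
opposite blue = red
opposite red  = blue

sameColour : Colour → Colour → Bool
sameColour blue = isBlue
sameColour red  = not ∘ isBlue

sameColour-refl : ∀ c → sameColour c c ≡ true
sameColour-refl blue = refl
sameColour-refl red  = refl

sameColour⇒≡ : ∀ c c′ → sameColour c c′ ≡ true → c ≡ c′
sameColour⇒≡ blue blue _ = refl
sameColour⇒≡ red  red  _ = refl

sameColour-sym : ∀ c c′ → sameColour c c′ ≡ sameColour c′ c
sameColour-sym blue blue = refl
sameColour-sym blue red  = refl
sameColour-sym red  blue = refl
sameColour-sym red  red  = refl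

sameColour-opposite : ∀ c → sameColour c (opposite c) ≡ false
sameColour-opposite blue = refl
sameColour-opposite red  = refl

singleVertex : Colour → Digraph
singleVertex c = record { size = 1 ; arc = λ _ _ → false ; colour = λ _ → c }

module Construction {k t : ℕ} (Gs : Fin k → Digraph) (Hs : Fin t → Digraph) where

  Option : Set
  Option = Fin (suc k) ⊎ Fin (suc t)

  _≟ₒ_ : (o o′ : Option) → Dec (o ≡ o′)
  _≟ₒ_ = ≡-dec _≟_ _≟_

  option : Option → Digraph
  option = [ singleVertex red ∷ Gs , singleVertex blue ∷ Hs ]′

  optionGame : Option → Game
  optionGame = [ minusOneG ∷ (λ i → digraphGame (Gs i)) , oneG ∷ (λ j → digraphGame (Hs j)) ]′

  target : Game
  target = mk (suc k) (suc t) (optionGame ∘ inj₁) (optionGame ∘ inj₂)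

  digraphGame-option : ∀ o → digraphGame (option o) ≡ optionGame o
  digraphGame-option (inj₁ zero)    = refl
  digraphGame-option (inj₁ (suc i)) = refl
  digraphGame-option (inj₂ zero)    = refl
  digraphGame-option (inj₂ (suc j)) = refl

  Copy : Option → Set
  Copy o = Fin (Digraph.size (option o))

  Core : Set
  Core = Option ⊎ (Σ (Fin (suc k)) (Copy ∘ inj₁) ⊎ Σ (Fin (suc t)) (Copy ∘ inj₂))

  nCore : ℕ
  nCore = (suc k + suc t) + (∑ (Digraph.size ∘ option ∘ inj₁) + ∑ (Digraph.size ∘ option ∘ inj₂))

  core↔ : Fin nCore ↔ Core
  core↔ = ↔-trans +↔⊎ (+↔⊎ ⊎-↔ ↔-trans +↔⊎ (Σ-Fin↔ _ ⊎-↔ Σ-Fin↔ _))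

  -- The number of spares of each colour, more than all gates and copy vertices together.
  M : ℕ
  M = suc nCore

  data Vertex : Set where
    gate  : Option → Vertex
    copy  : (o : Option) → Copy o → Vertex
    spare : Colour → Fin M → Vertex

  coreVertex : Core → Vertex
  coreVertex (inj₁ o)                = gate o
  coreVertex (inj₂ (inj₁ (i , u)))   = copy (inj₁ i) u
  coreVertex (inj₂ (inj₂ (j , u)))   = copy (inj₂ j) u

  fromCode : Core ⊎ (Fin M ⊎ Fin M) → Vertex
  fromCode (inj₁ c)        = coreVertex c
  fromCode (inj₂ (inj₁ j)) = spare red j
  fromCode (inj₂ (inj₂ j)) = spare blue j

  toCode : Vertex → Core ⊎ (Fin M ⊎ Fin M)
  toCode (gate o)          = inj₁ (inj₁ o)
  toCode (copy (inj₁ i) u) = inj₁ (inj₂ (inj₁ (i , u)))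
  toCode (copy (inj₂ j) u) = inj₁ (inj₂ (inj₂ (j , u)))
  toCode (spare red j)     = inj₂ (inj₁ j)
  toCode (spare blue j)    = inj₂ (inj₂ j)

  N : ℕ
  N = nCore + (M + M)

  vertex↔ : Fin N ↔ Vertex
  vertex↔ = ↔-trans +↔⊎ (↔-trans (core↔ ⊎-↔ +↔⊎) (mk↔ₛ′ fromCode toCode from-to to-from))
    where
    from-to : ∀ x → fromCode (toCode x) ≡ x
    from-to (gate o)          = refl
    from-to (copy (inj₁ i) u) = refl
    from-to (copy (inj₂ j) u) = refl
    from-to (spare red j)     = refl
    from-to (spare blue j)    = refl
    to-from : ∀ c → toCode (fromCode c) ≡ c
    to-from (inj₁ (inj₁ o))              = refl
    to-from (inj₁ (inj₂ (inj₁ (i , u)))) = refl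
    to-from (inj₁ (inj₂ (inj₂ (j , u)))) = refl
    to-from (inj₂ (inj₁ j))              = refl
    to-from (inj₂ (inj₂ j))              = refl

  decode : Fin N → Vertex
  decode = Inverse.to vertex↔

  encode : Vertex → Fin N
  encode = Inverse.from vertex↔

  decode-encode : ∀ x → decode (encode x) ≡ x
  decode-encode = Inverse.strictlyInverseˡ vertex↔

  encode-decode : ∀ v → encode (decode v) ≡ v
  encode-decode = Inverse.strictlyInverseʳ vertex↔

  encode-injective : ∀ {x y} → encode x ≡ encode y → x ≡ y
  encode-injective {x} {y} eq = trans (sym (decode-encode x)) (trans (cong decode eq) (decode-encode y))

  vertexColour : Vertex → Colour
  vertexColour (gate (inj₁ _)) = blue
  vertexColour (gate (inj₂ _)) = red
  vertexColour (copy o u)      = Digraph.colour (option o) u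
  vertexColour (spare c _)     = c

  -- Playing x deletes y exactly when keeps x y ≡ false: a gate keeps only its copy, a copy vertex
  -- acts as in its digraph and keeps the spares of the opposite colour, and a spare keeps the spares.
  keeps : Vertex → Vertex → Bool
  keeps (gate o)   (copy o′ _) = ⌊ o ≟ₒ o′ ⌋
  keeps (copy o u) (copy o′ w) with o ≟ₒ o′
  ... | yes refl = not (Digraph.arc (option o) u w)
  ... | no _     = false
  keeps (copy o u) (spare c _) = not (sameColour c (Digraph.colour (option o) u))
  keeps (spare _ _) (spare _ _) = true
  keeps _ _ = false

  construction : Digraph
  construction = record
    { size   = N
    ; arc    = λ v w → not (keeps (decode v) (decode w))
    ; colour = vertexColour ∘ decode
    }

  -- N reduces to a successor, so digraphGame construction is positionGame construction (suc fuel) all.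
  fuel : ℕ
  fuel = pred N

  all : VSet construction
  all _ = true

  after : Vertex → VSet construction
  after x = deleteV construction (encode x) all

  after-spec : ∀ x w → after x w ≡ not ⌊ encode x ≟ w ⌋ ∧ keeps x (decode w)
  after-spec x w rewrite decode-encode x with encode x ≟ w
  ... | yes _ = refl
  ... | no _  = not-involutive _

  after⇒keeps : ∀ x w → after x w ≡ true → keeps x (decode w) ≡ true
  after⇒keeps x w h = ∧-conicalʳ _ _ (trans (sym (after-spec x w)) h)

  after⇒≢ : ∀ x w → after x w ≡ true → decode w ≢ x
  after⇒≢ x w h dw≡x = not⌊≟⌋⇒≢ (∧-conicalˡ (not ⌊ encode x ≟ w ⌋) _ (trans (sym (after-spec x w)) h))
                                (trans (cong encode (sym dw≡x)) (encode-decode w))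

  keeps⇒after : ∀ x y → keeps x y ≡ true → x ≢ y → after x (encode y) ≡ true
  keeps⇒after x y h x≢y rewrite after-spec x (encode y) | decode-encode y with encode x ≟ encode y
  ... | yes ex≡ey = ⊥-elim (x≢y (encode-injective ex≡ey))
  ... | no _      = h

  count-after : ∀ x → count (after x) ≤ fuel
  count-after x = ≤-pred (≤-trans (count-deleteV construction (encode x) all refl) (≤-reflexive (count-all N)))

  keeps-copy-self : ∀ o u w → keeps (copy o u) (copy o w) ≡ not (Digraph.arc (option o) u w)
  keeps-copy-self o u w with o ≟ₒ o
  ... | yes refl = refl
  ... | no o≢o   = ⊥-elim (o≢o refl)

  gate-keeps-copy : ∀ o u → keeps (gate o) (copy o u) ≡ true
  gate-keeps-copy o u with o ≟ₒ o
  ... | yes _  = refl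
  ... | no o≢o = ⊥-elim (o≢o refl)

  gate-keeps⇒copy : ∀ o y → keeps (gate o) y ≡ true → ∃[ u ] y ≡ copy o u
  gate-keeps⇒copy o (copy o′ u) h with o ≟ₒ o′
  ... | yes refl = u , refl
  gate-keeps⇒copy o (gate _)    ()
  gate-keeps⇒copy o (spare _ _) ()

  copy-injective : ∀ {o u w} → copy o u ≡ copy o w → u ≡ w
  copy-injective refl = refl

  copy-embedding : ∀ o → Embedding (option o) construction
  copy-embedding o = record
    { embed           = λ u → encode (copy o u)
    ; embed-injective = λ {u} {w} → copy-injective ∘ encode-injective {copy o u} {copy o w}
    ; embed-colour    = λ u → cong vertexColour (decode-encode (copy o u))
    ; embed-arc       = λ u w → begin
        not (keeps (decode (encode (copy o u))) (decode (encode (copy o w))))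
          ≡⟨ cong₂ (λ x y → not (keeps x y)) (decode-encode (copy o u)) (decode-encode (copy o w)) ⟩
        not (keeps (copy o u) (copy o w))          ≡⟨ cong not (keeps-copy-self o u w) ⟩
        not (not (Digraph.arc (option o) u w))     ≡⟨ not-involutive _ ⟩
        Digraph.arc (option o) u w                 ∎
    }
    where open ≡-Reasoning

  gate-≃ : ∀ o → positionGame construction fuel (after (gate o)) ≃G optionGame o
  gate-≃ o = subst (positionGame construction fuel (after (gate o)) ≃G_) (digraphGame-option o)
    (positionGame-embed (copy-embedding o) fuel _ (after (gate o)) (λ _ → true) copy-image
       (count-after (gate o)) (≤-reflexive (count-all _)))
    where
    copy-image : IsImage (copy-embedding o) (after (gate o)) (λ _ → true)
    copy-image = record
      { image-agrees = λ u → keeps⇒after (gate o) (copy o u) (gate-keeps-copy o u) λ ()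
      ; image-only   = λ w h →
          let (u , dw≡copy) = gate-keeps⇒copy o (decode w) (after⇒keeps (gate o) w h)
          in u , trans (cong encode (sym dw≡copy)) (encode-decode w)
      }

  isSpare : Colour → Vertex → Bool
  isSpare c (spare c′ _) = sameColour c c′
  isSpare c _            = false

  NonGate : Vertex → Set
  NonGate (gate _) = ⊥
  NonGate _        = ⊤

  kept⇒NonGate : ∀ x y → keeps x y ≡ true → NonGate y
  kept⇒NonGate (gate _)    (gate _)    ()
  kept⇒NonGate (copy _ _)  (gate _)    ()
  kept⇒NonGate (spare _ _) (gate _)    ()
  kept⇒NonGate _           (copy _ _)  _ = tt
  kept⇒NonGate _           (spare _ _) _ = tt

  isSpare⇒colour : ∀ c y → isSpare c y ≡ true → vertexColour y ≡ c
  isSpare⇒colour c (spare c′ _) h = sym (sameColour⇒≡ c c′ h)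

  spares-independent : ∀ c s w → isSpare c (decode s) ≡ true → isSpare c (decode w) ≡ true → s ≢ w →
                       Digraph.arc construction s w ≡ false
  spares-independent c s w hs hw _ with decode s | decode w
  ... | spare _ _ | spare _ _ = refl

  keeps-spare : ∀ c y z → NonGate y → vertexColour y ≡ opposite c → isSpare c z ≡ true → keeps y z ≡ true
  keeps-spare c (copy o u) (spare c′ _) _ y-col z-spare
    rewrite y-col | sym (sameColour⇒≡ c c′ z-spare) | sameColour-opposite c = refl
  keeps-spare c (spare _ _) (spare _ _) _ _ _ = refl

  after-shielded : ∀ c x v w → after x v ≡ true → sameColour (opposite c) (vertexColour (decode v)) ≡ true →
                   isSpare c (decode w) ≡ true → Digraph.arc construction v w ≡ false
  after-shielded c x v w h v-col w-spare =
    cong not (keeps-spare c (decode v) (decode w) (kept⇒NonGate x (decode v) (after⇒keeps x v h))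
                          (sym (sameColour⇒≡ (opposite c) _ v-col)) w-spare)

  opposite-≢ : ∀ c → opposite c ≢ c
  opposite-≢ blue ()
  opposite-≢ red  ()

  spare-injective : ∀ {c i j} → spare c i ≡ spare c j → i ≡ j
  spare-injective refl = refl

  sparesAfter : Colour → Vertex → VSet construction
  sparesAfter c x w = after x w ∧ isSpare c (decode w)

  count-sparesAfter : ∀ c x → NonGate x → vertexColour x ≡ opposite c → M ≤ count (sparesAfter c x)
  count-sparesAfter c x x-nonGate x-col =
    count-≥-injection (sparesAfter c x) (encode ∘ spare c)
      (λ {i} {j} → spare-injective ∘ encode-injective {spare c i} {spare c j}) hits
    where
    hits : ∀ j → after x (encode (spare c j)) ∧ isSpare c (decode (encode (spare c j))) ≡ true
    hits j =
      ∧-true (keeps⇒after x (spare c j) (keeps-spare c x (spare c j) x-nonGate x-col (sameColour-refl c))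
                          λ x≡spare → opposite-≢ c (trans (sym x-col) (cong vertexColour x≡spare)))
             (trans (cong (isSpare c) (decode-encode (spare c j))) (sameColour-refl c))

  copy-keeps-mover : ∀ o u y → keeps (copy o u) y ≡ true →
                     sameColour (Digraph.colour (option o) u) (vertexColour y) ≡ true → ∃[ c ] coreVertex c ≡ y
  copy-keeps-mover o u (copy (inj₁ i) u′) _ _ = inj₂ (inj₁ (i , u′)) , refl
  copy-keeps-mover o u (copy (inj₂ j) u′) _ _ = inj₂ (inj₂ (j , u′)) , refl
  copy-keeps-mover o u (spare c′ _) kept same
    rewrite sameColour-sym c′ (Digraph.colour (option o) u) | same with () ← kept

  spare-keeps-mover : ∀ c m y → keeps (spare c m) y ≡ true → sameColour c (vertexColour y) ≡ true →
                      y ≢ spare c m → ∃[ j ] spare c (punchIn m j) ≡ y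
  spare-keeps-mover c m (spare c′ j) _ same y≢x with sameColour⇒≡ c c′ same
  ... | refl = punchOut m≢j , cong (spare c) (punchIn-punchOut m≢j)
    where
    m≢j : m ≢ j
    m≢j m≡j = y≢x (cong (spare c) (sym m≡j))

  encode-onto : ∀ {m} (f : Fin m → Vertex) w → ∃[ j ] f j ≡ decode w → ∃[ j ] encode (f j) ≡ w
  encode-onto f w (j , fj≡) = j , trans (cong encode fj≡) (encode-decode w)

  ownAfter : Colour → Vertex → VSet construction
  ownAfter c x w = after x w ∧ sameColour c (vertexColour (decode w))

  -- A copy vertex keeps only core vertices of its own colour, and a spare keeps only the other
  -- spares of its colour: either way the mover is left with at most nCore vertices.
  count-ownAfter : ∀ x → NonGate x → count (ownAfter (vertexColour x) x) ≤ nCore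
  count-ownAfter x@(copy o u) _ =
    count-≤-image (ownAfter (vertexColour x) x) (encode ∘ coreVertex ∘ Inverse.to core↔) λ w h →
      let (c , c≡) = copy-keeps-mover o u (decode w) (after⇒keeps x w (∧-conicalˡ (after x w) _ h))
                                      (∧-conicalʳ (after x w) _ h)
      in encode-onto (coreVertex ∘ Inverse.to core↔) w
           (Inverse.from core↔ c , trans (cong coreVertex (Inverse.strictlyInverseˡ core↔ c)) c≡)
  count-ownAfter x@(spare c m) _ =
    count-≤-image (ownAfter c x) (encode ∘ spare c ∘ punchIn m) λ w h →
      encode-onto (spare c ∘ punchIn m) w
        (spare-keeps-mover c m (decode w) (after⇒keeps x w (∧-conicalˡ (after x w) _ h))
                           (∧-conicalʳ (after x w) _ h) (after⇒≢ x w (∧-conicalˡ (after x w) _ h)))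

  spare-surplus : ∀ c x → NonGate x → vertexColour x ≡ opposite c →
                  suc (count (ownAfter (opposite c) x)) ≤ count (sparesAfter c x)
  spare-surplus c x x-nonGate x-col =
    ≤-trans (s≤s (subst (λ c′ → count (ownAfter c′ x) ≤ nCore) x-col (count-ownAfter x x-nonGate)))
            (count-sparesAfter c x x-nonGate x-col)

  module Red  = RedSpares construction (isSpare red ∘ decode)
                  (λ s → cong isBlue ∘ isSpare⇒colour red (decode s)) (spares-independent red)
  module Blue = BlueSpares construction (isSpare blue ∘ decode)
                  (λ s → cong isBlue ∘ isSpare⇒colour blue (decode s)) (spares-independent blue)

  blue-junk : ∀ x → NonGate x → vertexColour x ≡ blue →
              positionGame construction fuel (after x) ≤G minusOneG
  blue-junk x x-nonGate x-col = Red.positionGame≤negNatG fuel (after x) 1 (after-shielded red x)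
                                  (count-after x) (spare-surplus red x x-nonGate x-col)

  red-junk : ∀ x → NonGate x → vertexColour x ≡ red →
             oneG ≤G positionGame construction fuel (after x)
  red-junk x x-nonGate x-col = Blue.natG≤positionGame fuel (after x) 1 (after-shielded blue x)
                                 (count-after x) (spare-surplus blue x x-nonGate x-col)

  positionGame-after : ∀ v → positionGame construction fuel (deleteV construction v all) ≡
                             positionGame construction fuel (after (decode v))
  positionGame-after v =
    cong (λ u → positionGame construction fuel (deleteV construction u all)) (sym (encode-decode v))

  blue-reply : ∀ x → isBlue (vertexColour x) ≡ true → positionGame construction fuel (after x) ⧏ target
  blue-reply (gate (inj₁ i)) _ = ⧏-by-left _ target i (proj₁ (gate-≃ (inj₁ i)))
  blue-reply x@(copy _ _) x-blue = ⧏-by-left _ target zero (blue-junk x tt (sym (sameColour⇒≡ blue _ x-blue)))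
  blue-reply x@(spare _ _) x-blue = ⧏-by-left _ target zero (blue-junk x tt (sym (sameColour⇒≡ blue _ x-blue)))

  red-reply : ∀ x → not (isBlue (vertexColour x)) ≡ true → target ⧏ positionGame construction fuel (after x)
  red-reply (gate (inj₂ j)) _ = ⧏-by-right target _ j (proj₂ (gate-≃ (inj₂ j)))
  red-reply x@(copy _ _) x-red = ⧏-by-right target _ zero (red-junk x tt (sym (sameColour⇒≡ red _ x-red)))
  red-reply x@(spare _ _) x-red = ⧏-by-right target _ zero (red-junk x tt (sym (sameColour⇒≡ red _ x-red)))

  construction≃target : digraphGame construction ≃G target
  construction≃target = ≤G-intro game target left-game right-target , ≤G-intro target game left-target right-game
    where
    game : Game
    game = digraphGame construction

    left-game : ∀ i → leftOpt game i ⧏ target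
    left-game i with leftOpt⇒LeftMove construction fuel all i
    ... | v , v-blue , eq = subst (_⧏ target) (sym (trans eq (positionGame-after v))) (blue-reply (decode v) v-blue)

    right-game : ∀ i → target ⧏ rightOpt game i
    right-game i with rightOpt⇒RightMove construction fuel all i
    ... | v , v-red , eq = subst (target ⧏_) (sym (trans eq (positionGame-after v))) (red-reply (decode v) v-red)

    left-target : ∀ i → leftOpt target i ⧏ game
    left-target i =
      let (j , eq) = LeftMove⇒leftOpt construction fuel all (encode (gate (inj₁ i)))
                       (cong (isBlue ∘ vertexColour) (decode-encode (gate (inj₁ i))))
      in ⧏-by-left _ game j (subst (optionGame (inj₁ i) ≤G_) (sym eq) (proj₂ (gate-≃ (inj₁ i))))

    right-target : ∀ j → game ⧏ rightOpt target j
    right-target j =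
      let (i , eq) = RightMove⇒rightOpt construction fuel all (encode (gate (inj₂ j)))
                       (cong (not ∘ isBlue ∘ vertexColour) (decode-encode (gate (inj₂ j))))
      in ⧏-by-right game _ i (subst (_≤G optionGame (inj₂ j)) (sym eq) (proj₁ (gate-≃ (inj₂ j))))

lemma6 : (k t : ℕ) (Gs : Fin k → Digraph) (Hs : Fin t → Digraph) →
  Σ Digraph λ G →
    digraphGame G ≈G
      mk (suc k) (suc t)
         (minusOneG ∷ (λ i → digraphGame (Gs i)))
         (oneG ∷ (λ j → digraphGame (Hs j)))
lemma6 k t Gs Hs = construction , ≃G⇒≈G construction≃target
  where open Construction Gs Hs
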